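{- Let $q$ be a prime and let $p$ be a prime that is a primitive root modulo $q$ (i.e., $p \bmod q$ generates the cyclic group $\mathbb F_q^*$). Let $\mathbf w=\langle w_0,\dots,w_{q-1}\rangle\in\mathbb F_p^q$. Suppose $w_0+w_1+\cdots+w_{q-1}\ne 0$ and the $w_i$ are not all equal. Then the $\mathbb F_p$-vector space spanned by the cyclic shifts $\mathbf w,\mathbf w^{\oslash},\dots,\mathbf w^{\oslash^{q-1}}$ has dimension $q$.
   Context: For $\mathbf w=\langle w_0,\dots,w_{q-1}\rangle$, the cyclic shift is $\mathbf w^{\oslash}=\langle w_{q-1},w_0,\dots,w_{q-2}\rangle$, and $\mathbf w^{\oslash^a}$ denotes $a$-fold iteration. -}

module Defs where

open import Data.Nat as ℕ using (ℕ; zero; suc)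
open import Data.Integer as ℤ using (ℤ; +_)
open import Data.Integer.Divisibility using (_∣_)
open import Data.Fin using (Fin; zero; suc; fromℕ; inject₁)
open import Data.Product using (Σ; _×_)
open import Relation.Nullary using (¬_)

-- Congruence of integers modulo n; the field F_p is ℤ/pℤ, so elements of
-- F_p are represented by integers, and equality in F_p is ≡ (mod p).
_≡_[mod_] : ℤ → ℤ → ℕ → Set
a ≡ b [mod n ] = (+ n) ∣ (a ℤ.- b)

_≡ℕ_[mod_] : ℕ → ℕ → ℕ → Set
a ≡ℕ b [mod n ] = (+ a) ≡ (+ b) [mod n ]

IsPrimitiveRoot : ℕ → ℕ → Set
IsPrimitiveRoot p q =
  (a : ℕ) → 1 ℕ.≤ a → a ℕ.< q → Σ ℕ (λ k → (p ℕ.^ k) ≡ℕ a [mod q ])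

Vec' : ℕ → Set
Vec' q = Fin q → ℤ

sumFin : {n : ℕ} → (Fin n → ℤ) → ℤ
sumFin {zero}  f = + 0
sumFin {suc n} f = f zero ℤ.+ sumFin (λ i → f (suc i))

cshift : {q : ℕ} → Vec' q → Vec' q
cshift {suc n} w zero    = w (fromℕ n)
cshift {suc n} w (suc i) = w (inject₁ i)

cshift^ : {q : ℕ} → ℕ → Vec' q → Vec' q
cshift^ zero    w = w
cshift^ (suc a) w = cshift (cshift^ a w)

lincomb : {m q : ℕ} → (Fin m → ℤ) → (Fin m → Vec' q) → Vec' q
lincomb c g i = sumFin (λ j → c j ℤ.* g j i)

_≈_[mod_] : {q : ℕ} → Vec' q → Vec' q → ℕ → Set
u ≈ v [mod p ] = ∀ i → u i ≡ v i [mod p ]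

InSpan : (p : ℕ) {m q : ℕ} → (Fin m → Vec' q) → Vec' q → Set
InSpan p {m} g v = Σ (Fin m → ℤ) (λ c → v ≈ lincomb c g [mod p ])

LinIndep : (p : ℕ) {d q : ℕ} → (Fin d → Vec' q) → Set
LinIndep p b =
  ∀ c → lincomb c b ≈ (λ _ → + 0) [mod p ] → ∀ j → c j ≡ + 0 [mod p ]

SpanHasDim : (p : ℕ) {m q : ℕ} → (Fin m → Vec' q) → ℕ → Set
SpanHasDim p g d =
  Σ (Fin d → Vec' _) (λ b →
      ((j : Fin d) → InSpan p g (b j))
    × LinIndep p b
    × (∀ v → InSpan p g v → InSpan p b v))

module Submission where

open import Defs
open import Data.Nat as ℕ using (ℕ; zero; suc; _<_; _∸_; _!; NonZero; z≤n; s≤s)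
import Data.Nat.Properties as ℕ
open import Data.Nat.Divisibility as ℕ∣ using (divides; ∣⇒≤)
open import Data.Nat.DivMod using (m/n*n≡m; m<n⇒m%n≡m)
open import Data.Nat.Primality using (Prime; euclidsLemma; prime⇒nonTrivial; prime⇒nonZero)
open import Data.Nat.Combinatorics using (_C_; nCn≡1; k![n∸k]!∣n!)
open import Data.Nat.Combinatorics.Specification using (nCk≡n!/k![n-k]!)
open import Data.Integer as ℤ using (ℤ; +_)
import Data.Integer.Properties as ℤ
open import Data.Integer.Divisibility.Signed as ℤ∣ using (∣ᵤ⇒∣; ∣⇒∣ᵤ)
open import Data.Integer.DivMod using (_%ℕ_; _/ℕ_; n%ℕd<d; a≡a%ℕn+[a/ℕn]*n)
open import Data.Integer.Tactic.RingSolver using (solve-∀)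
open import Data.Fin using (Fin; zero; suc; toℕ; fromℕ; fromℕ<; inject₁; punchIn; punchOut)
open import Data.Fin.Properties
  using (_≟_; any?; toℕ-injective; toℕ-fromℕ<; toℕ-fromℕ; toℕ-inject₁; toℕ<n;
         injective⇒≤; punchOut-injective; punchInᵢ≢i)
open import Data.Fin.Permutation using (permutation)
open import Data.Product using (∃; _,_; proj₁; proj₂)
open import Data.Sum using (_⊎_; inj₁; inj₂; [_,_]′)
open import Function using (_∘_; id; flip; Injective)
open import Level using (0ℓ; _⊔_)
open import Relation.Nullary using (¬_; Dec; yes; no; contradiction)
open import Relation.Nullary.Decidable as Dec using (decidable-stable)
open import Relation.Binary.PropositionalEquality as ≡ using (_≡_; _≢_)
open import Algebra.Bundles using (CommutativeMonoid; Semiring; CommutativeRing)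
import Algebra.Properties.Semiring.Binomial
import Algebra.Properties.Semiring.Sum

-- Let T be the cyclic shift on F_p^q and suppose L w = 0 for L = Σ_a c_a T^a.  The powers
-- of T commute and F_p has characteristic p, so L^(p^k) = Σ_a c_a T^(p^k a); as p^k runs
-- through all nonzero residues mod q, this gives Σ_a c_a w_(x - r a) = 0 for all x and all
-- r ≢ 0 (mod q).  Summing Σ_a c_a w_(x + m (t - a)) over all m mod q, the terms m ≠ 0
-- vanish, while for a ≠ t the inner sum runs once through every entry of w; this yields
-- (S - q c_t) w_x = (S - c_t) W, where S = Σ_a c_a and W = Σ_i w_i.  As w is not constant,
-- q c_t = S; then W ≠ 0 gives c_t = S for every t, so L w = S W (1, …, 1), and S = 0.

p∤m! : ∀ {p} → Prime p → ∀ {m} → m < p → ¬ (p ℕ∣.∣ m !)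
p∤m! {p} p-prime {zero} _ p∣1 =
  contradiction (∣⇒≤ p∣1) (ℕ.<⇒≱ (ℕ.nonTrivial⇒n>1 p {{prime⇒nonTrivial p-prime}}))
p∤m! p-prime {suc m} m<p p∣m! with euclidsLemma (suc m) (m !) p-prime p∣m!
... | inj₁ p∣1+m = contradiction (∣⇒≤ p∣1+m) (ℕ.<⇒≱ m<p)
... | inj₂ p∣m!  = p∤m! p-prime (ℕ.<-trans (ℕ.n<1+n m) m<p) p∣m!

-- (p C k) k! (p ∸ k)! = p!, and p divides p! but neither of the two factorials.
p∣pCk : ∀ {p k} → Prime p → 0 < k → k < p → p ℕ∣.∣ p C k
p∣pCk {p} {k} p-prime 0<k k<p
  with euclidsLemma (p C k) (k ! ℕ.* (p ∸ k) !) p-prime (≡.subst (p ℕ∣.∣_) (≡.sym pCk*d≡p!) p∣p!)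
  where
    k≤p = ℕ.<⇒≤ k<p
    instance _ = ℕ.m*n≢0 (k !) ((p ∸ k) !) {{ℕ._!≢0 k}} {{ℕ._!≢0 (p ∸ k)}}
    pCk*d≡p! : (p C k) ℕ.* (k ! ℕ.* (p ∸ k) !) ≡ p !
    pCk*d≡p! = ≡.trans (≡.cong (ℕ._* (k ! ℕ.* (p ∸ k) !)) (nCk≡n!/k![n-k]! k≤p))
                       (m/n*n≡m (k![n∸k]!∣n! k≤p))
    p∣p! : p ℕ∣.∣ p !
    p∣p! = n∣n! {{prime⇒nonZero p-prime}}
      where n∣n! : ∀ {n} → .{{NonZero n}} → n ℕ∣.∣ n !
            n∣n! {suc n} = ℕ∣.m∣m*n (n !)
... | inj₁ p∣pCk = p∣pCk
... | inj₂ p∣d with euclidsLemma (k !) ((p ∸ k) !) p-prime p∣d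
...   | inj₁ p∣k!       = contradiction p∣k! (p∤m! p-prime k<p)
...   | inj₂ p∣[p∸k]!   = contradiction p∣[p∸k]! (p∤m! p-prime (ℕ.∸-monoʳ-< 0<k (ℕ.<⇒≤ k<p)))

module Frobenius {a ℓ} (S : Semiring a ℓ) where

  open Semiring S hiding (zero)
  open import Algebra.Properties.Semiring.Exp S using (_^_)
  open import Algebra.Properties.Semiring.Mult S using (_×_; ×-homo-1; ×-congʳ; ×-assocˡ)
  open import Algebra.Properties.Semiring.Sum S
    using (sum; sum-init-last; sum-cong-≋; sum-replicate; sum-replicate-zero; *-distribˡ-sum; *-distribʳ-sum)
  open import Relation.Binary.Reasoning.Setoid setoid

  vanishing-binomials⇒^-distrib-+ :
    ∀ n → .{{NonZero n}} → (∀ {k} → 0 < k → k < n → ∀ z → (n C k) × z ≈ 0#) →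
    ∀ {x y} → x * y ≈ y * x → (x + y) ^ n ≈ x ^ n + y ^ n
  vanishing-binomials⇒^-distrib-+ n@(suc m) vanish {x} {y} xy≈yx = begin
    (x + y) ^ n                                        ≈⟨ Binomial.theorem xy≈yx n ⟩
    term zero + sum (λ i → term (suc i))               ≈⟨ +-congˡ (sum-init-last (λ i → term (suc i))) ⟩
    term zero + (sum middle + term (suc (fromℕ m)))    ≈⟨ +-cong (trans (+-identityʳ _) (*-identityˡ _))
                                                                 (+-cong middle-sum≈0 last≈xⁿ) ⟩
    y ^ n + (0# + x ^ n)                               ≈⟨ trans (+-congˡ (+-identityˡ _)) (+-comm _ _) ⟩
    x ^ n + y ^ n                                      ∎
    where
    module Binomial = Algebra.Properties.Semiring.Binomial S x y
    term : Fin (suc n) → Carrier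
    term = Binomial.binomialTerm n
    middle : Fin m → Carrier
    middle i = term (suc (inject₁ i))
    middle≈0 : ∀ i → middle i ≈ 0#
    middle≈0 i = vanish (s≤s z≤n) (s≤s (≡.subst (_< m) (≡.sym (toℕ-inject₁ i)) (toℕ<n i))) _
    middle-sum≈0 : sum middle ≈ 0#
    middle-sum≈0 = trans (sum-cong-≋ middle≈0) (sum-replicate-zero m)
    last≈xⁿ : term (suc (fromℕ m)) ≈ x ^ n
    last≈xⁿ = begin
      term (suc (fromℕ m))
        ≡⟨ ≡.cong (λ k → (n C k) × (x ^ k * y ^ (n ∸ k))) (≡.cong suc (toℕ-fromℕ m)) ⟩
      (n C n) × (x ^ n * y ^ (n ∸ n))
        ≡⟨ ≡.cong₂ (λ c k → c × (x ^ n * y ^ k)) (nCn≡1 n) (ℕ.n∸n≡0 n) ⟩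
      1 × (x ^ n * 1#)
        ≈⟨ trans (×-homo-1 _) (*-identityʳ _) ⟩
      x ^ n
        ∎

  module _ {p} (p-prime : Prime p) (char : ∀ x → p × x ≈ 0#) where

    private instance
      p≢0 : NonZero p
      p≢0 = prime⇒nonZero p-prime

    frobenius-+ : ∀ {x y} → x * y ≈ y * x → (x + y) ^ p ≈ x ^ p + y ^ p
    frobenius-+ = vanishing-binomials⇒^-distrib-+ p vanish
      where
      vanish : ∀ {k} → 0 < k → k < p → ∀ z → (p C k) × z ≈ 0#
      vanish {k} 0<k k<p z with p∣pCk p-prime 0<k k<p
      ... | divides d pCk≡d*p = begin
        (p C k) × z         ≡⟨ ≡.cong (_× z) pCk≡d*p ⟩
        (d ℕ.* p) × z       ≈⟨ ×-assocˡ z d p ⟨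
        d × (p × z)         ≈⟨ ×-congʳ d (char z) ⟩
        d × 0#              ≈⟨ sum-replicate d ⟨
        sum {d} (λ _ → 0#)  ≈⟨ sum-replicate-zero d ⟩
        0#                  ∎

    frobenius-sum : ∀ {n} (f : Fin n → Carrier) → (∀ i j → f i * f j ≈ f j * f i) →
                    sum f ^ p ≈ sum (λ i → f i ^ p)
    frobenius-sum {zero}  f _    = 0^n≈0 p
      where 0^n≈0 : ∀ n → .{{NonZero n}} → 0# ^ n ≈ 0#
            0^n≈0 (suc n) = zeroˡ _
    frobenius-sum {suc n} f comm =
      trans (frobenius-+ head-comm-tail) (+-congˡ (frobenius-sum tail (λ i j → comm (suc i) (suc j))))
      where
      tail : Fin n → Carrier
      tail i = f (suc i)
      head-comm-tail : f zero * sum tail ≈ sum tail * f zero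
      head-comm-tail = begin
        f zero * sum tail            ≈⟨ *-distribˡ-sum (f zero) tail ⟩
        sum (λ i → f zero * tail i)  ≈⟨ sum-cong-≋ (λ i → comm zero (suc i)) ⟩
        sum (λ i → tail i * f zero)  ≈⟨ *-distribʳ-sum (f zero) tail ⟨
        sum tail * f zero            ∎

injective⇒surjective : ∀ {n} {f : Fin n → Fin n} → Injective _≡_ _≡_ f → ∀ j → ∃ λ i → f i ≡ j
injective⇒surjective {suc n} {f} f-injective j with any? (λ i → f i ≟ j)
... | yes hit  = hit
... | no  miss = contradiction (injective⇒≤ f′-injective) ℕ.1+n≰n
  where
  j≢f : ∀ i → j ≢ f i
  j≢f i j≡fi = miss (i , ≡.sym j≡fi)
  f′ : Fin (suc n) → Fin n
  f′ i = punchOut (j≢f i)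
  f′-injective : Injective _≡_ _≡_ f′
  f′-injective {x} {y} = f-injective ∘ punchOut-injective (j≢f x) (j≢f y)

module _ {a ℓ} (M : CommutativeMonoid a ℓ) where

  open CommutativeMonoid M renaming (ε to 0#)
  open import Algebra.Properties.CommutativeMonoid.Sum M
    using (sum; sum-permute; sum-remove; sum-cong-≋; sum-replicate-zero)

  sum-reindex-injective : ∀ {n} (g : Fin n → Carrier) {f : Fin n → Fin n} →
                          Injective _≡_ _≡_ f → sum (g ∘ f) ≈ sum g
  sum-reindex-injective g {f} f-injective = sym (sum-permute g π)
    where
    f⁻¹ = λ j → proj₁ (injective⇒surjective f-injective j)
    π = permutation f f⁻¹ (λ j → proj₂ (injective⇒surjective f-injective j))
                          (λ i → f-injective (proj₂ (injective⇒surjective f-injective (f i))))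

  sum-supported : ∀ {n} (g : Fin n → Carrier) t → (∀ i → i ≢ t → g i ≈ 0#) → sum g ≈ g t
  sum-supported {suc n} g t g≈0 = trans (sum-remove {i = t} g) (trans (∙-congˡ rest≈0) (identityʳ (g t)))
    where
    rest≈0 : sum (g ∘ punchIn t) ≈ 0#
    rest≈0 = trans (sum-cong-≋ (λ i → g≈0 (punchIn t i) (punchInᵢ≢i t i))) (sum-replicate-zero n)

module ℤMod (p : ℕ) where

  open import Data.Integer using (_+_; _*_; _-_; -_)

  -- A record rather than the bare divisibility, so that unification can read off x and y.
  infix 4 _≈_
  record _≈_ (x y : ℤ) : Set where
    constructor mod-p
    field ≈⇒∣ : + p ℤ∣.∣ (x - y)
  open _≈_ public

  private
    ∣⇒≈ : ∀ {x y d} → d ≡ x - y → + p ℤ∣.∣ d → x ≈ y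
    ∣⇒≈ ≡.refl = mod-p

  ≈⇒≡[mod] : ∀ {x y} → x ≈ y → x ≡ y [mod p ]
  ≈⇒≡[mod] = ∣⇒∣ᵤ ∘ ≈⇒∣

  ≡[mod]⇒≈ : ∀ {x y} → x ≡ y [mod p ] → x ≈ y
  ≡[mod]⇒≈ = mod-p ∘ ∣ᵤ⇒∣

  ≡⇒≈ : ∀ {x y} → x ≡ y → x ≈ y
  ≡⇒≈ {x} ≡.refl = ∣⇒≈ (≡.sym (ℤ.+-inverseʳ x)) (ℤ∣.divides (+ 0) ≡.refl)

  ≈-refl : ∀ {x} → x ≈ x
  ≈-refl = ≡⇒≈ ≡.refl

  ≈-sym : ∀ {x y} → x ≈ y → y ≈ x
  ≈-sym {x} {y} e = ∣⇒≈ (lemma x y) (ℤ∣.∣m⇒∣-m (≈⇒∣ e))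
    where lemma : ∀ x y → - (x - y) ≡ y - x
          lemma = solve-∀

  ≈-trans : ∀ {x y z} → x ≈ y → y ≈ z → x ≈ z
  ≈-trans {x} {y} {z} e f = ∣⇒≈ (lemma x y z) (ℤ∣.∣m∣n⇒∣m+n (≈⇒∣ e) (≈⇒∣ f))
    where lemma : ∀ x y z → (x - y) + (y - z) ≡ x - z
          lemma = solve-∀

  +-cong : ∀ {x y u v} → x ≈ y → u ≈ v → x + u ≈ y + v
  +-cong {x} {y} {u} {v} e f = ∣⇒≈ (lemma x y u v) (ℤ∣.∣m∣n⇒∣m+n (≈⇒∣ e) (≈⇒∣ f))
    where lemma : ∀ x y u v → (x - y) + (u - v) ≡ (x + u) - (y + v)
          lemma = solve-∀

  *-cong : ∀ {x y u v} → x ≈ y → u ≈ v → x * u ≈ y * v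
  *-cong {x} {y} {u} {v} e f =
    ∣⇒≈ (lemma x y u v)
        (ℤ∣.∣m∣n⇒∣m+n (ℤ∣.∣m⇒∣m*n u (≈⇒∣ e)) (ℤ∣.∣n⇒∣m*n y (≈⇒∣ f)))
    where lemma : ∀ x y u v → (x - y) * u + y * (u - v) ≡ x * u - y * v
          lemma = solve-∀

  +-congˡ : ∀ x {y z} → y ≈ z → x + y ≈ x + z
  +-congˡ x = +-cong (≈-refl {x})

  +-congʳ : ∀ z {x y} → x ≈ y → x + z ≈ y + z
  +-congʳ z e = +-cong e (≈-refl {z})

  *-congˡ : ∀ x {y z} → y ≈ z → x * y ≈ x * z
  *-congˡ x = *-cong (≈-refl {x})

  *-congʳ : ∀ z {x y} → x ≈ y → x * z ≈ y * z
  *-congʳ z e = *-cong e (≈-refl {z})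

  -‿cong : ∀ {x y} → x ≈ y → - x ≈ - y
  -‿cong {x} {y} e = ∣⇒≈ (lemma x y) (ℤ∣.∣m⇒∣-m (≈⇒∣ e))
    where lemma : ∀ x y → - (x - y) ≡ - x - - y
          lemma = solve-∀

  commutativeRing : CommutativeRing 0ℓ 0ℓ
  commutativeRing = record
    { Carrier = ℤ ; _≈_ = _≈_ ; _+_ = _+_ ; _*_ = _*_ ; -_ = -_ ; 0# = + 0 ; 1# = + 1
    ; isCommutativeRing = record
      { isRing = record
        { +-isAbelianGroup = record
          { isGroup = record
            { isMonoid = record
              { isSemigroup = record
                { isMagma = record
                  { isEquivalence = record { refl = ≈-refl ; sym = ≈-sym ; trans = ≈-trans }
                  ; ∙-cong = +-cong }
                ; assoc = λ x y z → ≡⇒≈ (ℤ.+-assoc x y z) }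
              ; identity = (λ x → ≡⇒≈ (ℤ.+-identityˡ x)) , (λ x → ≡⇒≈ (ℤ.+-identityʳ x)) }
            ; inverse = (λ x → ≡⇒≈ (ℤ.+-inverseˡ x)) , (λ x → ≡⇒≈ (ℤ.+-inverseʳ x))
            ; ⁻¹-cong = -‿cong }
          ; comm = λ x y → ≡⇒≈ (ℤ.+-comm x y) }
        ; *-cong = *-cong
        ; *-assoc = λ x y z → ≡⇒≈ (ℤ.*-assoc x y z)
        ; *-identity = (λ x → ≡⇒≈ (ℤ.*-identityˡ x)) , (λ x → ≡⇒≈ (ℤ.*-identityʳ x))
        ; distrib = (λ x y z → ≡⇒≈ (ℤ.*-distribˡ-+ x y z)) , (λ x y z → ≡⇒≈ (ℤ.*-distribʳ-+ x y z)) }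
      ; *-comm = λ x y → ≡⇒≈ (ℤ.*-comm x y) } }

  open CommutativeRing commutativeRing public using (semiring; +-commutativeMonoid; setoid)
  open import Algebra.Properties.Semiring.Mult semiring public using (_×_)
  open import Algebra.Properties.Semiring.Exp semiring public using (_^_)
  open import Algebra.Properties.Semiring.Exp semiring using (^-congˡ)
  open import Algebra.Properties.Semiring.Sum semiring public using (sum)

  sumFin≡sum : ∀ {m} (f : Fin m → ℤ) → sumFin f ≡ sum f
  sumFin≡sum {zero}  f = ≡.refl
  sumFin≡sum {suc m} f = ≡.cong (λ s → f zero + s) (sumFin≡sum (λ i → f (suc i)))

  x-y≈0⇒x≈y : ∀ x y → x - y ≈ + 0 → x ≈ y
  x-y≈0⇒x≈y x y = ∣⇒≈ (ℤ.+-identityʳ (x - y)) ∘ ≈⇒∣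

  x≈y⇒x-y≈0 : ∀ x y → x ≈ y → x - y ≈ + 0
  x≈y⇒x-y≈0 x y = ∣⇒≈ (≡.sym (ℤ.+-identityʳ (x - y))) ∘ ≈⇒∣

  infix 4 _≈?_
  _≈?_ : ∀ x y → Dec (x ≈ y)
  x ≈? y = Dec.map′ ≡[mod]⇒≈ ≈⇒≡[mod] (p ℕ∣.∣? ℤ.∣ x - y ∣)

  +p≈0 : + p ≈ + 0
  +p≈0 = ∣⇒≈ (≡.sym (ℤ.+-identityʳ (+ p))) ℤ∣.∣-refl

  ×≡* : ∀ n x → n × x ≡ + n * x
  ×≡* zero    x = ≡.sym (ℤ.*-zeroˡ x)
  ×≡* (suc n) x = ≡.trans (≡.cong (λ y → x + y) (×≡* n x)) (lemma x (+ n))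
    where lemma : ∀ x n → x + n * x ≡ (+ 1 + n) * x
          lemma = solve-∀

  char : ∀ x → p × x ≈ + 0
  char x = ≈-trans (≡⇒≈ (×≡* p x)) (≈-trans (*-congʳ x +p≈0) (≡⇒≈ (ℤ.*-zeroˡ x)))

  module _ .{{_ : NonZero p}} where

    x≈x%ℕp : ∀ x → x ≈ + (x %ℕ p)
    x≈x%ℕp x = ∣⇒≈ (≡.trans (≡.sym (lemma (+ (x %ℕ p)) (x /ℕ p) (+ p)))
                              (≡.cong (_- + (x %ℕ p)) (≡.sym (a≡a%ℕn+[a/ℕn]*n x p))))
                    (ℤ∣.divides (x /ℕ p) ≡.refl)
      where lemma : ∀ r q p → (r + q * p) - r ≡ q * p
            lemma = solve-∀

    private
      small-difference : ∀ {r s} → r ℕ.≤ s → s < p → + r ≈ + s → s ∸ r ≡ 0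
      small-difference {r} {s} r≤s s<p r≈s =
        ≡.trans (≡.sym (m<n⇒m%n≡m (ℕ.≤-<-trans (ℕ.m∸n≤m s r) s<p))) (ℕ∣.n∣m⇒m%n≡0 _ p p∣s∸r)
        where
        ∣r-s∣≡s∸r = ≡.trans (≡.cong ℤ.∣_∣ (ℤ.[+m]-[+n]≡m⊖n r s)) (ℤ.∣⊖∣-≤ r≤s)
        p∣s∸r = ≡.subst (p ℕ∣.∣_) ∣r-s∣≡s∸r (≈⇒≡[mod] r≈s)

    residue-unique : ∀ {r s} → r < p → s < p → + r ≈ + s → r ≡ s
    residue-unique {r} {s} r<p s<p r≈s with ℕ.≤-total r s
    ... | inj₁ r≤s = ℕ.≤-antisym r≤s (ℕ.m∸n≡0⇒m≤n (small-difference r≤s s<p r≈s))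
    ... | inj₂ s≤r = ≡.sym (ℕ.≤-antisym s≤r (ℕ.m∸n≡0⇒m≤n (small-difference s≤r r<p (≈-sym r≈s))))

  module _ (p-prime : Prime p) where

    private instance
      p≢0 : NonZero p
      p≢0 = prime⇒nonZero p-prime

    private
      ∣-0∣ : ∀ x → ℤ.∣ x - + 0 ∣ ≡ ℤ.∣ x ∣
      ∣-0∣ x = ≡.cong ℤ.∣_∣ (ℤ.+-identityʳ x)

    *≈0⇒≈0⊎≈0 : ∀ x y → x * y ≈ + 0 → x ≈ + 0 ⊎ y ≈ + 0
    *≈0⇒≈0⊎≈0 x y xy≈0
      with euclidsLemma ℤ.∣ x ∣ ℤ.∣ y ∣ p-prime
             (≡.subst (p ℕ∣.∣_) (≡.trans (∣-0∣ (x * y)) (ℤ.abs-* x y)) (≈⇒≡[mod] xy≈0))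
    ... | inj₁ p∣x = inj₁ (≡[mod]⇒≈ (≡.subst (p ℕ∣.∣_) (≡.sym (∣-0∣ x)) p∣x))
    ... | inj₂ p∣y = inj₂ (≡[mod]⇒≈ (≡.subst (p ℕ∣.∣_) (≡.sym (∣-0∣ y)) p∣y))

    fermat : ∀ x → x ^ p ≈ x
    fermat x = ≈-trans (^-congˡ p (x≈x%ℕp x)) (≈-trans (fermatℕ (x %ℕ p)) (≈-sym (x≈x%ℕp x)))
      where
      open Frobenius semiring using (frobenius-+)
      1^n≡1 : ∀ n → (+ 1) ^ n ≡ + 1
      1^n≡1 zero    = ≡.refl
      1^n≡1 (suc n) = ≡.trans (ℤ.*-identityˡ _) (1^n≡1 n)
      fermatℕ : ∀ n → (+ n) ^ p ≈ + n
      fermatℕ zero    = 0^n≈0 p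
        where 0^n≈0 : ∀ n → .{{NonZero n}} → (+ 0) ^ n ≈ + 0
              0^n≈0 (suc n) = ≈-refl
      fermatℕ (suc n) = ≈-trans (frobenius-+ p-prime char (≡⇒≈ (ℤ.*-comm (+ 1) (+ n))))
                                (+-cong (≡⇒≈ (1^n≡1 p)) (fermatℕ n))

module LinearEndomorphisms {c ℓ} (R : CommutativeRing c ℓ) (n : ℕ) where

  open CommutativeRing R renaming (semiring to R-semiring)
  open import Algebra.Properties.CommutativeSemigroup +-commutativeSemigroup using (interchange)
  open import Algebra.Properties.CommutativeSemigroup *-commutativeSemigroup using (x∙yz≈y∙xz)
  module R where
    open import Algebra.Properties.Semiring.Exp R-semiring public using (_^_)
    open import Algebra.Properties.Semiring.Mult R-semiring public using (_×_)
    open import Algebra.Properties.Semiring.Sum R-semiring public using (sum)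

  Vector : Set c
  Vector = Fin n → Carrier

  infix 4 _≋_
  _≋_ : Vector → Vector → Set ℓ
  u ≋ v = ∀ i → u i ≈ v i

  -- Without eta, operators are compared through their action instead of by normalising
  -- their proof fields, which keeps conversion checking fast.
  record Linear : Set (c ⊔ ℓ) where
    no-eta-equality
    field
      apply  : Vector → Vector
      cong   : ∀ {u v} → u ≋ v → apply u ≋ apply v
      +-homo : ∀ u v → apply (λ i → u i + v i) ≋ (λ i → apply u i + apply v i)
      *-homo : ∀ s v → apply (λ i → s * v i) ≋ (λ i → s * apply v i)
  open Linear public

  infix 4 _≃_
  record _≃_ (f g : Linear) : Set (c ⊔ ℓ) where
    constructor pointwise
    field at : ∀ v → apply f v ≋ apply g v
  open _≃_ public

  apply-0 : ∀ f → apply f (λ _ → 0#) ≋ (λ _ → 0#)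
  apply-0 f i = trans (cong f (λ _ → sym (zeroˡ 0#)) i) (trans (*-homo f 0# (λ _ → 0#) i) (zeroˡ _))

  infixl 6 _⊕_
  infixl 7 _⊙_

  _⊕_ : Linear → Linear → Linear
  apply  (f ⊕ g) v i   = apply f v i + apply g v i
  cong   (f ⊕ g) u≋v i = +-cong (cong f u≋v i) (cong g u≋v i)
  +-homo (f ⊕ g) u v i = trans (+-cong (+-homo f u v i) (+-homo g u v i)) (interchange _ _ _ _)
  *-homo (f ⊕ g) s v i = trans (+-cong (*-homo f s v i) (*-homo g s v i)) (sym (distribˡ s _ _))

  _⊙_ : Linear → Linear → Linear
  apply  (f ⊙ g) v     = apply f (apply g v)
  cong   (f ⊙ g) u≋v   = cong f (cong g u≋v)
  +-homo (f ⊙ g) u v i = trans (cong f (+-homo g u v) i) (+-homo f _ _ i)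
  *-homo (f ⊙ g) s v i = trans (cong f (*-homo g s v) i) (*-homo f s _ i)

  scalar : Carrier → Linear
  apply  (scalar s) v i   = s * v i
  cong   (scalar s) u≋v i = *-congˡ (u≋v i)
  +-homo (scalar s) u v i = distribˡ s (u i) (v i)
  *-homo (scalar s) t v i = x∙yz≈y∙xz s t (v i)

  semiring : Semiring (c ⊔ ℓ) (c ⊔ ℓ)
  semiring = record
    { Carrier = Linear ; _≈_ = _≃_ ; _+_ = _⊕_ ; _*_ = _⊙_ ; 0# = scalar 0# ; 1# = scalar 1#
    ; isSemiring = record
      { isSemiringWithoutAnnihilatingZero = record
        { +-isCommutativeMonoid = record
          { isMonoid = record
            { isSemigroup = record
              { isMagma = record
                { isEquivalence = record
                  { refl  = pointwise λ _ _ → refl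
                  ; sym   = λ f≃g → pointwise λ v i → sym (at f≃g v i)
                  ; trans = λ f≃g g≃h → pointwise λ v i → trans (at f≃g v i) (at g≃h v i) }
                ; ∙-cong = λ f≃g h≃k → pointwise λ v i → +-cong (at f≃g v i) (at h≃k v i) }
              ; assoc = λ f g h → pointwise λ v i → +-assoc _ _ _ }
            ; identity = (λ f → pointwise λ v i → trans (+-congʳ (zeroˡ _)) (+-identityˡ _))
                       , (λ f → pointwise λ v i → trans (+-congˡ (zeroˡ _)) (+-identityʳ _)) }
          ; comm = λ f g → pointwise λ v i → +-comm _ _ }
        ; *-cong = λ {f} {g} {h} {k} f≃g h≃k → pointwise λ v i →
                     trans (cong f (at h≃k v) i) (at f≃g (apply k v) i)
        ; *-assoc = λ f g h → pointwise λ v i → refl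
        ; *-identity = (λ f → pointwise λ v i → *-identityˡ _)
                     , (λ f → pointwise λ v i → cong f (λ j → *-identityˡ (v j)) i)
        ; distrib = (λ f g h → pointwise λ v i → +-homo f _ _ i) , (λ f g h → pointwise λ v i → refl) }
      ; zero = (λ f → pointwise λ v i → trans (zeroˡ _) (sym (zeroˡ _)))
             , (λ f → pointwise λ v i →
                  trans (cong f (λ j → zeroˡ (v j)) i) (trans (apply-0 f i) (sym (zeroˡ _)))) } }

  open Semiring semiring public using () renaming (sym to ≃-sym; trans to ≃-trans)
  open import Algebra.Properties.Semiring.Exp semiring public using (_^_)
  open import Algebra.Properties.Semiring.Exp semiring using (^-homo-*)
  open import Algebra.Properties.Semiring.Mult semiring using (_×_)
  open import Algebra.Properties.Semiring.Sum semiring public using (sum; sum-cong-≋)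

  apply-× : ∀ k f v i → apply (k × f) v i ≈ k R.× apply f v i
  apply-× zero    f v i = zeroˡ (v i)
  apply-× (suc k) f v i = +-congˡ (apply-× k f v i)

  apply-sum : ∀ {m} (fs : Fin m → Linear) v i → apply (sum fs) v i ≈ R.sum (λ a → apply (fs a) v i)
  apply-sum {zero}  fs v i = zeroˡ (v i)
  apply-sum {suc m} fs v i = +-congˡ (apply-sum (λ a → fs (suc a)) v i)

  ^-annihilates : ∀ f {w} → apply f w ≋ (λ _ → 0#) → ∀ k → .{{NonZero k}} → apply (f ^ k) w ≋ (λ _ → 0#)
  ^-annihilates f fw≈0 1               i = trans (cong f (λ j → *-identityˡ _) i) (fw≈0 i)
  ^-annihilates f fw≈0 (suc k@(suc _)) i = trans (cong f (^-annihilates f fw≈0 k) i) (apply-0 f i)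

  module Polynomials (T : Linear) where

    monomial : Carrier → ℕ → Linear
    monomial s e = scalar s ⊙ T ^ e

    monomial-cong : ∀ {s t e f} → s ≈ t → e ≡ f → monomial s e ≃ monomial t f
    monomial-cong s≈t ≡.refl = pointwise λ v i → *-congʳ s≈t

    monomial-* : ∀ s t e f → monomial s e ⊙ monomial t f ≃ monomial (s * t) (e ℕ.+ f)
    monomial-* s t e f = pointwise λ v i →
      trans (*-congˡ (*-homo (T ^ e) t (apply (T ^ f) v) i))
            (trans (sym (*-assoc s t _)) (*-congˡ (sym (at (^-homo-* T e f) v i))))

    monomial-comm : ∀ s t e f → monomial s e ⊙ monomial t f ≃ monomial t f ⊙ monomial s e
    monomial-comm s t e f = ≃-trans (monomial-* s t e f)
      (≃-trans (monomial-cong (*-comm s t) (ℕ.+-comm e f)) (≃-sym (monomial-* t s f e)))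

    monomial-^ : ∀ s e k → monomial s e ^ k ≃ monomial (s R.^ k) (k ℕ.* e)
    monomial-^ s e zero    = pointwise λ v i → sym (*-identityˡ _)
    monomial-^ s e (suc k) = pointwise λ v i →
      trans (cong (monomial s e) (at (monomial-^ s e k) v) i) (at (monomial-* s (s R.^ k) e (k ℕ.* e)) v i)

    frobenius-polynomial : ∀ {p} → Prime p → (∀ x → p R.× x ≈ 0#) →
                           ∀ {m} (s : Fin m → Carrier) (e : Fin m → ℕ) →
                           sum (λ a → monomial (s a) (e a)) ^ p ≃ sum (λ a → monomial (s a R.^ p) (p ℕ.* e a))
    frobenius-polynomial {p} p-prime char s e =
      ≃-trans (frobenius-sum p-prime char′ _ (λ a b → monomial-comm (s a) (s b) (e a) (e b)))
              (sum-cong-≋ (λ a → monomial-^ (s a) (e a) p))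
      where
      open Frobenius semiring using (frobenius-sum)
      char′ : ∀ f → p × f ≃ scalar 0#
      char′ f = pointwise λ v i → trans (apply-× p f v i) (trans (char _) (sym (zeroˡ _)))

module Indices (n : ℕ) where

  q : ℕ
  q = suc n
  module Q = ℤMod q
  open import Data.Integer using (_+_; _*_; _-_)

  index : ℤ → Fin q
  index x = fromℕ< (n%ℕd<d x q)

  _⟪_⟫ : Vec' q → ℤ → ℤ
  w ⟪ x ⟫ = w (index x)

  index≈ : ∀ x → + toℕ (index x) Q.≈ x
  index≈ x = Q.≈-trans (Q.≡⇒≈ (≡.cong +_ (toℕ-fromℕ< _))) (Q.≈-sym (Q.x≈x%ℕp x))

  index-≈ : ∀ {x} {i : Fin q} → x Q.≈ + toℕ i → index x ≡ i
  index-≈ {x} {i} x≈i =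
    toℕ-injective (Q.residue-unique (toℕ<n (index x)) (toℕ<n i) (Q.≈-trans (index≈ x) x≈i))

  index-≡⇒≈ : ∀ {x y} → index x ≡ index y → x Q.≈ y
  index-≡⇒≈ {x} {y} eq =
    Q.≈-trans (Q.≈-sym (index≈ x)) (Q.≈-trans (Q.≡⇒≈ (≡.cong (+_ ∘ toℕ) eq)) (index≈ y))

  toℕ-≈-injective : ∀ {i j : Fin q} → + toℕ i Q.≈ + toℕ j → i ≡ j
  toℕ-≈-injective {i} {j} = toℕ-injective ∘ Q.residue-unique (toℕ<n i) (toℕ<n j)

  ⟪⟫-cong : ∀ w {x y} → x Q.≈ y → w ⟪ x ⟫ ≡ w ⟪ y ⟫
  ⟪⟫-cong w {x} {y} x≈y = ≡.cong w (index-≈ (Q.≈-trans x≈y (Q.≈-sym (index≈ y))))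

  ⟪toℕ⟫ : ∀ w i → w ⟪ + toℕ i ⟫ ≡ w i
  ⟪toℕ⟫ w i = ≡.cong w (index-≈ Q.≈-refl)

  cshift^-⟪⟫ : ∀ e w i → cshift^ e w i ≡ w ⟪ + toℕ i - + e ⟫
  cshift^-⟪⟫ zero    w i       = ≡.sym (≡.cong w (index-≈ (Q.≡⇒≈ (ℤ.+-identityʳ (+ toℕ i)))))
  cshift^-⟪⟫ (suc e) w zero    = ≡.trans (cshift^-⟪⟫ e w (fromℕ n))
    (⟪⟫-cong w (Q.x-y≈0⇒x≈y (+ toℕ (fromℕ n) - + e) (+ 0 - + suc e)
                             (Q.≈-trans (Q.≡⇒≈ difference≡q) Q.+p≈0)))
    where
    difference≡q : (+ toℕ (fromℕ n) - + e) - (+ 0 - + suc e) ≡ + q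
    difference≡q = ≡.trans (≡.cong (λ m → (+ m - + e) - (+ 0 - (+ 1 + + e))) (toℕ-fromℕ n)) (lemma (+ n) (+ e))
      where lemma : ∀ n e → (n - e) - (+ 0 - (+ 1 + e)) ≡ + 1 + n
            lemma = solve-∀
  cshift^-⟪⟫ (suc e) w (suc i) = ≡.trans (cshift^-⟪⟫ e w (inject₁ i)) (≡.cong (w ⟪_⟫) shifted)
    where
    shifted : + toℕ (inject₁ i) - + e ≡ (+ 1 + + toℕ i) - (+ 1 + + e)
    shifted = ≡.trans (≡.cong (λ m → + m - + e) (toℕ-inject₁ i)) (lemma (+ toℕ i) (+ e))
      where lemma : ∀ i e → i - e ≡ (+ 1 + i) - (+ 1 + e)
            lemma = solve-∀

  progression-injective : Prime q → ∀ {d} → ¬ (d Q.≈ + 0) → ∀ x →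
                          Injective _≡_ _≡_ (λ (m : Fin q) → index (x - d * + toℕ m))
  progression-injective q-prime {d} d≉0 x {m} {m′} eq =
    [ flip contradiction d≉0 , ≡.sym ∘ toℕ-≈-injective ∘ Q.x-y≈0⇒x≈y (+ toℕ m′) (+ toℕ m) ]′
      (Q.*≈0⇒≈0⊎≈0 q-prime d (+ toℕ m′ - + toℕ m) d[m′-m]≈0)
    where
    a = x - d * + toℕ m
    b = x - d * + toℕ m′
    lemma : ∀ x d m m′ → (x - d * m) - (x - d * m′) ≡ d * (m′ - m)
    lemma = solve-∀
    d[m′-m]≈0 : d * (+ toℕ m′ - + toℕ m) Q.≈ + 0
    d[m′-m]≈0 =
      Q.≈-trans (Q.≡⇒≈ (≡.sym (lemma x d (+ toℕ m) (+ toℕ m′)))) (Q.x≈y⇒x-y≈0 a b (index-≡⇒≈ eq))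

module FrobeniusOrbit {n p : ℕ} (p-prime : Prime p) (w : Vec' (suc n)) (c : Fin (suc n) → ℤ)
                      (relation : ∀ i → sumFin (λ a → c a ℤ.* cshift^ (toℕ a) w i) ≡ + 0 [mod p ]) where

  module P = ℤMod p
  module ΣP = Algebra.Properties.Semiring.Sum P.semiring
  open LinearEndomorphisms P.commutativeRing (suc n)
  open import Data.Integer using (_*_)

  private instance
    p≢0 : NonZero p
    p≢0 = prime⇒nonZero p-prime

  shift : Linear
  apply  shift             = cshift
  cong   shift u≋v zero    = u≋v (fromℕ n)
  cong   shift u≋v (suc i) = u≋v (inject₁ i)
  +-homo shift u v zero    = P.≈-refl
  +-homo shift u v (suc i) = P.≈-refl
  *-homo shift s v zero    = P.≈-refl
  *-homo shift s v (suc i) = P.≈-refl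

  apply-shift^ : ∀ e v → apply (shift ^ e) v ≋ cshift^ e v
  apply-shift^ zero    v i = P.≡⇒≈ (ℤ.*-identityˡ (v i))
  apply-shift^ (suc e) v i = cong shift (apply-shift^ e v) i

  open Polynomials shift

  -- The image of Σ_a c_a T^a under k iterations of the Frobenius x ↦ x^p.
  orbit : ℕ → Linear
  orbit k = sum (λ a → monomial (c a) (p ℕ.^ k ℕ.* toℕ a))

  orbit-suc : ∀ k → orbit (suc k) ≃ orbit k ^ p
  orbit-suc k = ≃-sym (≃-trans (frobenius-polynomial p-prime P.char c (λ a → p ℕ.^ k ℕ.* toℕ a))
    (sum-cong-≋ (λ a → monomial-cong (P.fermat p-prime (c a)) (≡.sym (ℕ.*-assoc p (p ℕ.^ k) (toℕ a))))))

  apply-orbit : ∀ k i → apply (orbit k) w i P.≈ ΣP.sum (λ a → c a * cshift^ (p ℕ.^ k ℕ.* toℕ a) w i)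
  apply-orbit k i = P.≈-trans (apply-sum (λ a → monomial (c a) (p ℕ.^ k ℕ.* toℕ a)) w i)
    (ΣP.sum-cong-≋ (λ a → P.*-congˡ (c a) (apply-shift^ (p ℕ.^ k ℕ.* toℕ a) w i)))

  orbit-annihilates : ∀ k → apply (orbit k) w ≋ (λ _ → + 0)
  orbit-annihilates zero    i = begin
    apply (orbit 0) w i                             ≈⟨ apply-orbit 0 i ⟩
    ΣP.sum (λ a → c a * cshift^ (1 ℕ.* toℕ a) w i)  ≈⟨ ΣP.sum-cong-≋ 1*a≡a ⟩
    ΣP.sum (λ a → c a * cshift^ (toℕ a) w i)        ≡⟨ P.sumFin≡sum (λ a → c a * cshift^ (toℕ a) w i) ⟨
    sumFin (λ a → c a * cshift^ (toℕ a) w i)        ≈⟨ P.≡[mod]⇒≈ (relation i) ⟩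
    + 0                                             ∎
    where
    open import Relation.Binary.Reasoning.Setoid P.setoid
    1*a≡a : ∀ a → c a * cshift^ (1 ℕ.* toℕ a) w i P.≈ c a * cshift^ (toℕ a) w i
    1*a≡a a = P.≡⇒≈ (≡.cong (λ e → c a * cshift^ e w i) (ℕ.*-identityˡ (toℕ a)))
  orbit-annihilates (suc k) i =
    P.≈-trans (at (orbit-suc k) w i) (^-annihilates (orbit k) (orbit-annihilates k) p i)

  frobenius-orbit : ∀ k i → ΣP.sum (λ a → c a * cshift^ (p ℕ.^ k ℕ.* toℕ a) w i) P.≈ + 0
  frobenius-orbit k i = P.≈-trans (P.≈-sym (apply-orbit k i)) (orbit-annihilates k i)

module Independence {n p : ℕ} (q-prime : Prime (suc n)) (p-prime : Prime p) (p-primitive : IsPrimitiveRoot p (suc n))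
                    (w : Vec' (suc n)) (c : Fin (suc n) → ℤ)
                    (relation : ∀ i → sumFin (λ a → c a ℤ.* cshift^ (toℕ a) w i) ≡ + 0 [mod p ]) where

  open Indices n
  module P = ℤMod p
  open FrobeniusOrbit p-prime w c relation using (frobenius-orbit)
  open import Data.Integer using (_+_; _*_; _-_)
  open import Algebra.Properties.Semiring.Sum P.semiring
    using (sum; sum-cong-≋; sum-cong-≗; ∑-comm; ∑-distrib-+; *-distribˡ-sum; *-distribʳ-sum;
           sum-replicate; sum-replicate-zero)
  open import Relation.Binary.Reasoning.Setoid P.setoid

  vanishing : ∀ r → ¬ (r Q.≈ + 0) → ∀ x → sum (λ a → c a * w ⟪ x - r * + toℕ a ⟫) P.≈ + 0
  vanishing r r≉0 x with p-primitive (r %ℕ q) (ℕ.n≢0⇒n>0 r%q≢0) (n%ℕd<d r q)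
    where r%q≢0 : r %ℕ q ≢ 0
          r%q≢0 r%q≡0 = r≉0 (Q.≈-trans (Q.x≈x%ℕp r) (Q.≡⇒≈ (≡.cong +_ r%q≡0)))
  ... | k , pᵏ≡r =
    P.≈-trans (sum-cong-≋ (λ a → P.≡⇒≈ (≡.cong (λ y → c a * y) (reindex a)))) (frobenius-orbit k (index x))
    where
    pᵏ≈r : + (p ℕ.^ k) Q.≈ r
    pᵏ≈r = Q.≈-trans (Q.≡[mod]⇒≈ pᵏ≡r) (Q.≈-sym (Q.x≈x%ℕp r))
    reindex : ∀ a → w ⟪ x - r * + toℕ a ⟫ ≡ cshift^ (p ℕ.^ k ℕ.* toℕ a) w (index x)
    reindex a = ≡.sym (≡.trans (cshift^-⟪⟫ e w (index x)) (⟪⟫-cong w (Q.+-cong (index≈ x) (Q.-‿cong e≈ra))))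
      where
      e = p ℕ.^ k ℕ.* toℕ a
      e≈ra : + e Q.≈ r * + toℕ a
      e≈ra = Q.≈-trans (Q.≡⇒≈ (ℤ.pos-* (p ℕ.^ k) (toℕ a))) (Q.*-congʳ (+ toℕ a) pᵏ≈r)

  S W Q : ℤ
  S = sum c
  W = sum w
  Q = + q

  sum-progression : ∀ {d} → ¬ (d Q.≈ + 0) → ∀ x → sum (λ (m : Fin q) → w ⟪ x - d * + toℕ m ⟫) P.≈ W
  sum-progression d≉0 x = sum-reindex-injective P.+-commutativeMonoid w (progression-injective q-prime d≉0 x)

  nonzero-index : ∀ (m : Fin n) → ¬ (+ toℕ (suc m) Q.≈ + 0)
  nonzero-index m e with toℕ-≈-injective {suc m} {zero} e
  ... | ()

  distinct-index : ∀ {a t : Fin q} → a ≢ t → ¬ (+ toℕ a - + toℕ t Q.≈ + 0)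
  distinct-index {a} {t} a≢t = a≢t ∘ toℕ-≈-injective ∘ Q.x-y≈0⇒x≈y (+ toℕ a) (+ toℕ t)

  module _ (t : Fin q) (x : ℤ) where

    private
      t′ : ℤ
      t′ = + toℕ t
      term : Fin q → Fin q → ℤ
      term m a = c a * w ⟪ (x + + toℕ m * t′) - + toℕ m * + toℕ a ⟫
      column-term : Fin q → Fin q → ℤ
      column-term a m = w ⟪ x - (+ toℕ a - t′) * + toℕ m ⟫
      column : Fin q → ℤ
      column a = sum (column-term a)

    double-sum≈S·w : sum (λ m → sum (term m)) P.≈ S * w ⟪ x ⟫
    double-sum≈S·w = begin
      sum (term zero) + sum (λ m → sum (term (suc m)))  ≈⟨ P.+-cong first rest ⟩
      S * w ⟪ x ⟫ + + 0                                 ≡⟨ ℤ.+-identityʳ _ ⟩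
      S * w ⟪ x ⟫                                       ∎
      where
      at-zero : ∀ a → (x + + 0 * t′) - + 0 * + toℕ a ≡ x
      at-zero a = lemma x t′ (+ toℕ a)
        where lemma : ∀ x t a → (x + + 0 * t) - + 0 * a ≡ x
              lemma = solve-∀
      first : sum (term zero) P.≈ S * w ⟪ x ⟫
      first = P.≈-trans (sum-cong-≋ (λ a → P.≡⇒≈ (≡.cong (λ y → c a * w ⟪ y ⟫) (at-zero a))))
                        (P.≈-sym (*-distribʳ-sum (w ⟪ x ⟫) c))
      rest : sum (λ m → sum (term (suc m))) P.≈ + 0
      rest = P.≈-trans (sum-cong-≋ λ m → vanishing (+ toℕ (suc m)) (nonzero-index m) (x + + toℕ (suc m) * t′))
                       (sum-replicate-zero n)

    double-sum≈columns : sum (λ m → sum (term m)) P.≈ sum (λ a → c a * column a)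
    double-sum≈columns = begin
      sum (λ m → sum (term m))
        ≈⟨ ∑-comm term ⟩
      sum (λ a → sum (λ m → term m a))
        ≈⟨ sum-cong-≋ (λ a → sum-cong-≋ (λ m → P.≡⇒≈ (regroup m a))) ⟩
      sum (λ a → sum (λ m → c a * column-term a m))
        ≈⟨ sum-cong-≋ (λ a → P.≈-sym (*-distribˡ-sum (c a) (column-term a))) ⟩
      sum (λ a → c a * column a)
        ∎
      where
      regroup : ∀ m a → term m a ≡ c a * column-term a m
      regroup m a = ≡.cong (λ y → c a * w ⟪ y ⟫) (lemma x t′ (+ toℕ m) (+ toℕ a))
        where lemma : ∀ x t m a → (x + m * t) - m * a ≡ x - (a - t) * m
              lemma = solve-∀

    column≈W : ∀ {a} → a ≢ t → column a P.≈ W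
    column≈W {a} a≢t = sum-progression {+ toℕ a - t′} (distinct-index a≢t) x

    column-t : column t P.≈ Q * w ⟪ x ⟫
    column-t = begin
      column t
        ≈⟨ sum-cong-≋ {q} (λ m → P.≡⇒≈ (≡.cong (w ⟪_⟫) (lemma x t′ (+ toℕ m)))) ⟩
      sum (λ (_ : Fin q) → w ⟪ x ⟫)
        ≈⟨ sum-replicate q {w ⟪ x ⟫} ⟩
      q P.× w ⟪ x ⟫
        ≡⟨ P.×≡* q (w ⟪ x ⟫) ⟩
      Q * w ⟪ x ⟫
        ∎
      where lemma : ∀ x t m → x - (t - t) * m ≡ x
            lemma = solve-∀

    columns≈ : sum (λ a → c a * column a) P.≈ S * W + c t * (Q * w ⟪ x ⟫ - W)
    columns≈ = begin
      sum (λ a → c a * column a)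
        ≡⟨ sum-cong-≗ (λ a → split (c a) (column a) W) ⟩
      sum (λ a → c a * W + c a * (column a - W))
        ≈⟨ ∑-distrib-+ (λ a → c a * W) (λ a → c a * (column a - W)) ⟩
      sum (λ a → c a * W) + sum (λ a → c a * (column a - W))
        ≈⟨ P.+-cong (P.≈-sym (*-distribʳ-sum W c)) (sum-supported P.+-commutativeMonoid _ t off-t) ⟩
      S * W + c t * (column t - W)
        ≈⟨ P.+-congˡ (S * W) (P.*-congˡ (c t) (P.+-congʳ (ℤ.- W) column-t)) ⟩
      S * W + c t * (Q * w ⟪ x ⟫ - W)
        ∎
      where
      split : ∀ c y z → c * y ≡ c * z + c * (y - z)
      split = solve-∀
      off-t : ∀ a → a ≢ t → c a * (column a - W) P.≈ + 0
      off-t a a≢t = P.≈-trans (P.*-congˡ (c a) (P.x≈y⇒x-y≈0 _ _ (column≈W a≢t))) (P.≡⇒≈ (ℤ.*-zeroʳ (c a)))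

    key : (S - c t * Q) * w ⟪ x ⟫ P.≈ (S - c t) * W
    key = begin
      (S - c t * Q) * w ⟪ x ⟫
        ≡⟨ lemma₁ S (c t) Q (w ⟪ x ⟫) ⟩
      S * w ⟪ x ⟫ - c t * (Q * w ⟪ x ⟫)
        ≈⟨ P.+-congʳ (ℤ.- (c t * (Q * w ⟪ x ⟫))) S·w≈ ⟩
      (S * W + c t * (Q * w ⟪ x ⟫ - W)) - c t * (Q * w ⟪ x ⟫)
        ≡⟨ lemma₂ S W (c t) (Q * w ⟪ x ⟫) ⟩
      (S - c t) * W
        ∎
      where
      S·w≈ : S * w ⟪ x ⟫ P.≈ S * W + c t * (Q * w ⟪ x ⟫ - W)
      S·w≈ = P.≈-trans (P.≈-sym double-sum≈S·w) (P.≈-trans double-sum≈columns columns≈)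
      lemma₁ : ∀ s c q y → (s - c * q) * y ≡ s * y - c * (q * y)
      lemma₁ = solve-∀
      lemma₂ : ∀ s w c y → (s * w + c * (y - w)) - c * y ≡ (s - c) * w
      lemma₂ = solve-∀

  module _ (W≉0 : ¬ (W P.≈ + 0)) (nonconstant : ¬ (∀ i j → w i P.≈ w j)) where

    -- Deciding D ≈ 0 replaces picking two indices at which w differs.
    c·Q≈S : ∀ t → c t * Q P.≈ S
    c·Q≈S t = P.≈-sym (P.x-y≈0⇒x≈y S (c t * Q) (decidable-stable (D P.≈? + 0) ¬¬D≈0))
      where
      D : ℤ
      D = S - c t * Q
      D·[wᵢ-wⱼ]≈0 : ∀ i j → D * (w i - w j) P.≈ + 0
      D·[wᵢ-wⱼ]≈0 i j = begin
        D * (w i - w j)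
          ≡⟨ distrib D (w i) (w j) ⟩
        D * w i - D * w j
          ≡⟨ ≡.cong₂ (λ u v → D * u - D * v) (⟪toℕ⟫ w i) (⟪toℕ⟫ w j) ⟨
        D * w ⟪ + toℕ i ⟫ - D * w ⟪ + toℕ j ⟫
          ≈⟨ P.x≈y⇒x-y≈0 _ _ (P.≈-trans (key t (+ toℕ i)) (P.≈-sym (key t (+ toℕ j)))) ⟩
        + 0
          ∎
        where distrib : ∀ d x y → d * (x - y) ≡ d * x - d * y
              distrib = solve-∀
      ¬¬D≈0 : ¬ ¬ (D P.≈ + 0)
      ¬¬D≈0 D≉0 = nonconstant λ i j →
        [ flip contradiction D≉0 , P.x-y≈0⇒x≈y (w i) (w j) ]′
          (P.*≈0⇒≈0⊎≈0 p-prime D (w i - w j) (D·[wᵢ-wⱼ]≈0 i j))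

    c≈S : ∀ t → c t P.≈ S
    c≈S t = [ P.≈-sym ∘ P.x-y≈0⇒x≈y S (c t) , flip contradiction W≉0 ]′
              (P.*≈0⇒≈0⊎≈0 p-prime (S - c t) W [S-c]·W≈0)
      where
      [S-c]·W≈0 : (S - c t) * W P.≈ + 0
      [S-c]·W≈0 = begin
        (S - c t) * W
          ≈⟨ key t (+ 0) ⟨
        (S - c t * Q) * w ⟪ + 0 ⟫
          ≈⟨ P.*-congʳ (w ⟪ + 0 ⟫) (P.x≈y⇒x-y≈0 S (c t * Q) (P.≈-sym (c·Q≈S t))) ⟩
        + 0 * w ⟪ + 0 ⟫
          ≡⟨ ℤ.*-zeroˡ (w ⟪ + 0 ⟫) ⟩
        + 0
          ∎

    S≈0 : S P.≈ + 0
    S≈0 = [ id , flip contradiction W≉0 ]′ (P.*≈0⇒≈0⊎≈0 p-prime S W S·W≈0)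
      where
      1≉0 : ¬ (+ 1 Q.≈ + 0)
      1≉0 1≈0 with Q.residue-unique (ℕ.nonTrivial⇒n>1 q {{prime⇒nonTrivial q-prime}}) (s≤s z≤n) 1≈0
      ... | ()
      progression : Fin q → ℤ
      progression a = w ⟪ + 0 - + 1 * + toℕ a ⟫
      S·W≈0 : S * W P.≈ + 0
      S·W≈0 = begin
        S * W                           ≈⟨ P.*-congˡ S (sum-progression 1≉0 (+ 0)) ⟨
        S * sum progression             ≈⟨ *-distribˡ-sum S progression ⟩
        sum (λ a → S * progression a)   ≈⟨ sum-cong-≋ (λ a → P.*-congʳ (progression a) (c≈S a)) ⟨
        sum (λ a → c a * progression a) ≈⟨ vanishing (+ 1) 1≉0 (+ 0) ⟩
        + 0                             ∎

    coefficients-vanish : ∀ t → c t P.≈ + 0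
    coefficients-vanish t = P.≈-trans (c≈S t) S≈0

member-in-span : ∀ p {m q} (g : Fin m → Vec' q) j → InSpan p g (g j)
member-in-span p {m} g j = unit , λ i → P.≈⇒≡[mod] (P.≈-sym (begin
  sumFin (λ a → unit a ℤ.* g a i)  ≡⟨ P.sumFin≡sum (λ a → unit a ℤ.* g a i) ⟩
  P.sum (λ a → unit a ℤ.* g a i)   ≈⟨ sum-supported P.+-commutativeMonoid _ j (off-j i) ⟩
  unit j ℤ.* g j i                 ≡⟨ at-j i ⟩
  g j i                            ∎))
  where
  module P = ℤMod p
  open import Relation.Binary.Reasoning.Setoid P.setoid
  unit : Fin m → ℤ
  unit a with a ≟ j
  ... | yes _ = + 1
  ... | no  _ = + 0
  off-j : ∀ i a → a ≢ j → unit a ℤ.* g a i P.≈ + 0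
  off-j i a a≢j with a ≟ j
  ... | yes a≡j = contradiction a≡j a≢j
  ... | no  _   = P.≈-refl
  at-j : ∀ i → unit j ℤ.* g j i ≡ g j i
  at-j i with j ≟ j
  ... | yes _   = ℤ.*-identityˡ (g j i)
  ... | no  j≢j = contradiction ≡.refl j≢j

theorem3 : (q p : ℕ) → Prime q → Prime p → IsPrimitiveRoot p q
    → (w : Vec' q)
    → ¬ (sumFin w ≡ + 0 [mod p ])
    → ¬ (∀ i j → w i ≡ w j [mod p ])
    → SpanHasDim p (λ (a : Fin q) → cshift^ (toℕ a) w) q
theorem3 zero    p q-prime = contradiction (ℕ.nonTrivial⇒n>1 0 {{prime⇒nonTrivial q-prime}}) λ ()
theorem3 (suc n) p q-prime p-prime p-primitive w Σw≢0 nonconstant =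
  shifts , member-in-span p shifts , independent , λ _ v∈span → v∈span
  where
  module P = ℤMod p
  shifts : Fin (suc n) → Vec' (suc n)
  shifts a = cshift^ (toℕ a) w
  independent : LinIndep p shifts
  independent c relation = P.≈⇒≡[mod] ∘ coefficients-vanish W≉0 w-nonconstant
    where
    open Independence q-prime p-prime p-primitive w c relation using (coefficients-vanish)
    W≉0 : ¬ (P.sum w P.≈ + 0)
    W≉0 = Σw≢0 ∘ P.≈⇒≡[mod] ∘ P.≈-trans (P.≡⇒≈ (P.sumFin≡sum w))
    w-nonconstant : ¬ (∀ i j → w i P.≈ w j)
    w-nonconstant w≈ = nonconstant λ i j → P.≈⇒≡[mod] (w≈ i j)
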